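{- Let $n\ge2$ be even with $2$-adic valuation $\nu\ge1$, $m_i=n/2^i$ for $0\le i\le\nu$. Let $a\in\mathbb{F}_{2^n}^*$, $b\in\mathbb{F}_4^*$, and $x\in\mathbb{F}_{2^n}^*$, written uniquely as $x=uy$ with $u=u_1u_2\cdots u_\nu\in U$ ($u_i\in U_i$) and $y\in\mathbb{F}_{2^{m_\nu}}^*$. Then \[ f_{a,b}(x)=f_{a,b}(u)=f_a(u_1)+g_b(u_\nu). \]
   Context: All fields $\mathbb{F}_{2^{m_i}}$ are viewed inside $\mathbb{F}_{2^n}$. $\mathrm{Tr}_l$ denotes the absolute trace of $\mathbb{F}_{2^l}$. For $1\le i\le\nu$, $U_i\subset\mathbb{F}_{2^{m_{i-1}}}^*$ is the group of $(2^{m_i}+1)$-th roots of unity, and $U=\{u_1\cdots u_\nu: u_i\in U_i\}$; the map $(u_1,\dots,u_\nu,y)\mapsto u_1\cdots u_\nu y$ is a bijection $U_1\times\cdots\times U_\nu\times\mathbb{F}_{2^{m_\nu}}^*\to\mathbb{F}_{2^n}^*$, and $u_i$ is called the $U_i$-component. $\psi_{m_0}(x)=x^{(2^{n}-1)/3}\in\mathbb{F}_4$. Define $f_a(x)=\mathrm{Tr}_n(ax^{2^{m_1}-1})$, $g_b(x)=\mathrm{Tr}_2(b\,\psi_{m_0}(x))$ and $f_{a,b}=f_a+g_b$. -}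

module Defs where

open import Level using (Level)
open import Data.Nat as ℕ using (ℕ; zero; suc; _∸_)
open import Data.Nat.DivMod using (_/_)
open import Data.Fin using (Fin; zero; suc; fromℕ)
open import Data.Product using (_×_; Σ)
open import Relation.Nullary using (¬_)
open import Relation.Binary.PropositionalEquality as PE using (_≡_)
open import Function.Bundles using (Bijection)
open import Algebra.Bundles using (CommutativeRing)

record IsFieldOfOrder2^ {c ℓ : Level} (R : CommutativeRing c ℓ) (n : ℕ) : Set (c Level.⊔ ℓ) where
  open CommutativeRing R using (Carrier; _≈_; _*_; 0#; 1#; setoid)
  field
    nontrivial : ¬ (1# ≈ 0#)
    inverse    : ∀ x → ¬ (x ≈ 0#) → Σ Carrier (λ y → x * y ≈ 1#)
    card       : Bijection setoid (PE.setoid (Fin (2 ℕ.^ n)))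

module FieldNotions {c ℓ : Level} (R : CommutativeRing c ℓ) where
  open CommutativeRing R using (_+_; _*_)
  open CommutativeRing R public using (Carrier; _≈_; 0#; 1#) renaming (_+_ to _⊕_; _*_ to _⊛_)

  pow : Carrier → ℕ → Carrier
  pow x zero    = 1#
  pow x (suc k) = x * pow x k

  Tr : ℕ → Carrier → Carrier
  Tr zero    x = 0#
  Tr (suc l) x = pow x (2 ℕ.^ l) + Tr l x

  InSub : ℕ → Carrier → Set ℓ
  InSub m x = pow x (2 ℕ.^ m) ≈ x

  ψ : ℕ → Carrier → Carrier
  ψ n x = pow x ((2 ℕ.^ n ∸ 1) / 3)

  f : (n m₁ : ℕ) → Carrier → Carrier → Carrier
  f n m₁ a x = Tr n (a * pow x (2 ℕ.^ m₁ ∸ 1))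

  g : ℕ → Carrier → Carrier → Carrier
  g n b x = Tr 2 (b * ψ n x)

  fab : (n m₁ : ℕ) → Carrier → Carrier → Carrier → Carrier
  fab n m₁ a b x = f n m₁ a x + g n b x

  prod : (k : ℕ) → (Fin k → Carrier) → Carrier
  prod zero    us = 1#
  prod (suc k) us = us zero * prod k (λ i → us (suc i))

-- The statement parameters: n = 2^ν · k with k odd and ν = suc ν' ≥ 1,
-- m_i = n / 2^i = 2^(ν - i) · k  for 0 ≤ i ≤ ν.
mIdx : (ν k i : ℕ) → ℕ
mIdx ν k i = 2 ℕ.^ (ν ∸ i) ℕ.* k

module Submission where

-- Write n = 2^ν k with k odd, m_i = 2^(ν-i) k, e₁ = 2^{m_1} - 1 and
-- E = (2^n - 1)/3.  The function f_a only sees x through x^{e₁} and g_b only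
-- through ψ(x) = x^E, so it suffices to show that the "irrelevant" factors
-- have e₁-th or E-th power equal to 1:
--
--   * y ∈ F_{2^k}^* has order dividing 2^k - 1, which divides e₁ (as k ∣ m_1)
--     and E (as 3 ∤ 2^k - 1 for k odd);
--   * u_i ∈ U_i has order dividing 2^{m_i} + 1, which divides 2^{m_{i-1}} - 1;
--     for i ≥ 2 this divides e₁, and for i < ν it divides E because m_i is
--     even, so that 3 ∤ 2^{m_i} + 1.

open import Defs
open import Level using (Level)
open import Data.Nat using (ℕ; zero; suc; _+_; _*_; _^_; _%_; _∸_; _/_; _<_; _≤_; z≤n; s≤s)
open import Data.Nat.Divisibility using (_∣_; divides)
open import Data.Fin using (Fin; zero; suc; fromℕ; toℕ; inject₁)
open import Data.Product using (_×_; _,_; proj₂)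
open import Relation.Nullary using (¬_)
open import Relation.Binary.PropositionalEquality using (_≡_; refl; cong; cong₂; subst)
open import Algebra.Bundles using (CommutativeRing)

module Arithmetic where
  open import Data.Nat.Properties
    using (m+[n∸m]≡n; m^n>0; ^-distribˡ-+-*; +-suc; +-identityʳ; *-comm; m∸n+n≡m; ≤-refl)
  open import Data.Nat.Divisibility using (_∣0; ∣m∣n⇒∣m+n; ∣m+n∣m⇒∣n; m∣m*n; ∣n⇒∣m*n; >⇒∤)
  open import Data.Nat.DivMod using (m*n/n≡m; m≡m%n+[m/n]*n)
  open import Data.Nat.Coprimality using (Coprime; coprime-divisor)
  open import Data.Nat.Primality using (Prime; prime?; prime⇒irreducible)
  open import Data.Nat.Tactic.RingSolver using (solve-∀)
  open import Data.Sum using ([_,_])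
  open import Data.Empty using (⊥-elim)
  open import Function using (id)
  open import Relation.Nullary.Decidable using (from-yes)
  open import Relation.Binary.PropositionalEquality using (sym; trans; module ≡-Reasoning)

  2^a≡1+[2^a∸1] : ∀ a → 2 ^ a ≡ suc (2 ^ a ∸ 1)
  2^a≡1+[2^a∸1] a = sym (m+[n∸m]≡n (m^n>0 2 a))

  2^-mono-∣ : ∀ {a b} → a ≤ b → 2 ^ a ∣ 2 ^ b
  2^-mono-∣ {a} {b} a≤b =
    divides (2 ^ (b ∸ a)) (trans (cong (2 ^_) (sym (m∸n+n≡m a≤b))) (^-distribˡ-+-* 2 (b ∸ a) a))

  -- x ∣ y ⇒ x ∣ (1+x)(1+y) - 1 = y + x(1+y); the induction step for Mersenne numbers.
  ∣-pred-product : ∀ {x y} → x ∣ y → x ∣ suc x * suc y ∸ 1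
  ∣-pred-product {y = y} x∣y = ∣m∣n⇒∣m+n x∣y (m∣m*n (suc y))

  mersenne-∣ : ∀ {a b} → a ∣ b → 2 ^ a ∸ 1 ∣ 2 ^ b ∸ 1
  mersenne-∣ {a} (divides q refl) = multiple q
    where
    multiple : ∀ q → 2 ^ a ∸ 1 ∣ 2 ^ (q * a) ∸ 1
    multiple zero    = _ ∣0
    multiple (suc q) = subst (λ N → 2 ^ a ∸ 1 ∣ N ∸ 1) split (∣-pred-product (multiple q))
      where
      split : suc (2 ^ a ∸ 1) * suc (2 ^ (q * a) ∸ 1) ≡ 2 ^ (suc q * a)
      split = sym (trans (^-distribˡ-+-* 2 a (q * a))
                         (cong₂ _*_ (2^a≡1+[2^a∸1] a) (2^a≡1+[2^a∸1] (q * a))))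

  -- 2^c + 1 ∣ 2^{2c} - 1 = (2^c - 1)(2^c + 1).
  fermat-∣ : ∀ c → 2 ^ c + 1 ∣ 2 ^ (2 * c) ∸ 1
  fermat-∣ c = divides s (begin
      2 ^ (2 * c) ∸ 1           ≡⟨ cong (λ e → 2 ^ (c + e) ∸ 1) (+-identityʳ c) ⟩
      2 ^ (c + c) ∸ 1           ≡⟨ cong (_∸ 1) (^-distribˡ-+-* 2 c c) ⟩
      2 ^ c * 2 ^ c ∸ 1         ≡⟨ cong (λ x → x * x ∸ 1) (2^a≡1+[2^a∸1] c) ⟩
      s + s * suc s             ≡⟨ difference-of-squares s ⟩
      s * (suc s + 1)           ≡⟨ cong (λ x → s * (x + 1)) (sym (2^a≡1+[2^a∸1] c)) ⟩
      s * (2 ^ c + 1)           ∎)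
    where
    open ≡-Reasoning
    s = 2 ^ c ∸ 1
    difference-of-squares : ∀ s → s + s * suc s ≡ s * (suc s + 1)
    difference-of-squares = solve-∀

  -- 3 = 2^2 - 1 divides 4^d - 1.
  3∣4^d∸1 : ∀ d → 3 ∣ 2 ^ (2 * d) ∸ 1
  3∣4^d∸1 d = mersenne-∣ (divides d (*-comm 2 d))

  -- 4^d + 1 = (4^d - 1) + 2, so it is ≡ 2 (mod 3).
  3∤4^d+1 : ∀ d → ¬ 3 ∣ 2 ^ (2 * d) + 1
  3∤4^d+1 d 3∣ = >⇒∤ ≤-refl (∣m+n∣m⇒∣n (subst (3 ∣_) shift 3∣) (3∣4^d∸1 d))
    where
    shift : 2 ^ (2 * d) + 1 ≡ (2 ^ (2 * d) ∸ 1) + 2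
    shift = trans (cong (_+ 1) (2^a≡1+[2^a∸1] (2 * d))) (sym (+-suc (2 ^ (2 * d) ∸ 1) 1))

  -- 2^{2d+1} - 1 = 2(4^d - 1) + 1, so it is ≡ 1 (mod 3).
  3∤2^odd∸1 : ∀ d → ¬ 3 ∣ 2 ^ suc (2 * d) ∸ 1
  3∤2^odd∸1 d 3∣ =
    >⇒∤ (s≤s (s≤s z≤n)) (∣m+n∣m⇒∣n (subst (3 ∣_) shift 3∣) (∣n⇒∣m*n 2 (3∣4^d∸1 d)))
    where
    M = 2 ^ (2 * d) ∸ 1
    double : ∀ M → M + (suc M + 0) ≡ 2 * M + 1
    double = solve-∀
    shift : 2 ^ suc (2 * d) ∸ 1 ≡ 2 * M + 1
    shift = trans (cong (λ x → 2 * x ∸ 1) (2^a≡1+[2^a∸1] (2 * d))) (double M)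

  3∤2^k∸1 : ∀ {k} → k % 2 ≡ 1 → ¬ 3 ∣ 2 ^ k ∸ 1
  3∤2^k∸1 {k} k-odd = subst (λ e → ¬ 3 ∣ 2 ^ e ∸ 1) (sym k≡2q+1) (3∤2^odd∸1 (k / 2))
    where
    k≡2q+1 : k ≡ suc (2 * (k / 2))
    k≡2q+1 = trans (m≡m%n+[m/n]*n k 2) (cong₂ _+_ k-odd (*-comm (k / 2) 2))

  3-prime : Prime 3
  3-prime = from-yes (prime? 3)

  ∤-prime⇒coprime : ∀ {p d} → Prime p → ¬ p ∣ d → Coprime d p
  ∤-prime⇒coprime {d = d} p-prime p∤d (i∣d , i∣p) =
    [ id , (λ i≡p → ⊥-elim (p∤d (subst (_∣ d) i≡p i∣d))) ] (prime⇒irreducible p-prime i∣p)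

  -- The exponent of ψ_{m_0}: for n even, (2^n - 1)/3 is an integer.
  ψ-exponent : ℕ → ℕ
  ψ-exponent n = (2 ^ n ∸ 1) / 3

  ∣-ψ-exponent : ∀ {n d} → 2 ∣ n → d ∣ 2 ^ n ∸ 1 → ¬ 3 ∣ d → d ∣ ψ-exponent n
  ∣-ψ-exponent {n} {d} 2∣n d∣ 3∤d with mersenne-∣ 2∣n
  ... | divides q 2^n∸1≡q*3 = subst (d ∣_) (sym quotient) d∣q
    where
    d∣q : d ∣ q
    d∣q = coprime-divisor (∤-prime⇒coprime 3-prime 3∤d) (subst (d ∣_) (trans 2^n∸1≡q*3 (*-comm q 3)) d∣)
    quotient : ψ-exponent n ≡ q
    quotient = trans (cong (_/ 3) 2^n∸1≡q*3) (m*n/n≡m q 3)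

module Tower (ν k : ℕ) where
  open import Data.Nat.Properties
    using (*-comm; *-assoc; *-identityˡ; ∸-monoʳ-≤; n∸n≡0; <⇒≤; ≤-trans)
  open import Data.Nat.Divisibility using (∣-trans; *-monoˡ-∣)
  open import Relation.Binary.PropositionalEquality using (sym; trans)
  open Arithmetic

  m : ℕ → ℕ
  m = mIdx ν k

  ∸-step : ∀ {i ν} → i < ν → ν ∸ i ≡ suc (ν ∸ suc i)
  ∸-step {zero}  {suc ν} _       = refl
  ∸-step {suc i} {suc ν} (s≤s i<ν) = ∸-step i<ν

  m-∣ : ∀ {i j} → i ≤ j → m j ∣ m i
  m-∣ i≤j = *-monoˡ-∣ k (2^-mono-∣ (∸-monoʳ-≤ ν i≤j))

  m-halve : ∀ {i} → i < ν → m i ≡ 2 * m (suc i)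
  m-halve {i} i<ν = trans (cong (λ e → 2 ^ e * k) (∸-step i<ν)) (*-assoc 2 (2 ^ (ν ∸ suc i)) k)

  m-top : m ν ≡ k
  m-top = trans (cong (λ e → 2 ^ e * k) (n∸n≡0 ν)) (*-identityˡ k)

  fermat-step : ∀ {i} → i < ν → 2 ^ m (suc i) + 1 ∣ 2 ^ m i ∸ 1
  fermat-step {i} i<ν = subst (λ e → 2 ^ m (suc i) + 1 ∣ 2 ^ e ∸ 1) (sym (m-halve i<ν)) (fermat-∣ (m (suc i)))

  2∣m₀ : 0 < ν → 2 ∣ m 0
  2∣m₀ 0<ν = divides (m 1) (trans (m-halve 0<ν) (*-comm 2 (m 1)))

  unit-circle-∣-ψ : ∀ {i} → suc i < ν → 2 ^ m (suc i) + 1 ∣ ψ-exponent (m 0)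
  unit-circle-∣-ψ {i} i+1<ν =
    ∣-ψ-exponent (2∣m₀ (≤-trans (s≤s z≤n) i+1<ν))
      (∣-trans (fermat-step (<⇒≤ i+1<ν)) (mersenne-∣ (m-∣ {j = i} z≤n)))
      (subst (λ e → ¬ 3 ∣ 2 ^ e + 1) (sym (m-halve i+1<ν)) (3∤4^d+1 (m (suc (suc i)))))

  bottom-∣-ψ : k % 2 ≡ 1 → 0 < ν → 2 ^ m ν ∸ 1 ∣ ψ-exponent (m 0)
  bottom-∣-ψ k-odd 0<ν =
    ∣-ψ-exponent (2∣m₀ 0<ν) (mersenne-∣ (m-∣ {j = ν} z≤n))
      (subst (λ e → ¬ 3 ∣ 2 ^ e ∸ 1) (sym m-top) (3∤2^k∸1 {k} k-odd))

module PowerLemmas {c ℓ : Level} (R : CommutativeRing c ℓ) where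
  open CommutativeRing R
    using (setoid; commutativeSemiring; +-cong; *-cong; *-congˡ; *-congʳ;
           *-comm; *-assoc; *-identityˡ; *-identityʳ)
    renaming (refl to ≈-refl; sym to ≈-sym; trans to ≈-trans)
  open FieldNotions R using (Carrier; _≈_; _⊛_; 1#; pow; Tr; InSub; f; g; prod)
  open import Algebra.Properties.CommutativeSemiring.Exp commutativeSemiring
    using (^-assocʳ; ^-distrib-*) renaming (_^_ to _^ᴿ_)
  import Data.Nat.Properties as ℕ
  open import Relation.Binary.Reasoning.Setoid setoid
  open Arithmetic using (2^a≡1+[2^a∸1]; ψ-exponent)

  -- pow agrees with the library's exponentiation, whose laws we reuse.
  pow≡^ : ∀ x e → pow x e ≡ x ^ᴿ e
  pow≡^ x zero    = refl
  pow≡^ x (suc e) = cong (x ⊛_) (pow≡^ x e)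

  pow-congˡ : ∀ e {x y} → x ≈ y → pow x e ≈ pow y e
  pow-congˡ zero    x≈y = ≈-refl
  pow-congˡ (suc e) x≈y = *-cong x≈y (pow-congˡ e x≈y)

  1-pow : ∀ e → pow 1# e ≈ 1#
  1-pow zero    = ≈-refl
  1-pow (suc e) = ≈-trans (*-identityˡ (pow 1# e)) (1-pow e)

  pow-distrib : ∀ x y e → pow (x ⊛ y) e ≈ pow x e ⊛ pow y e
  pow-distrib x y e = begin
    pow (x ⊛ y) e          ≡⟨ pow≡^ (x ⊛ y) e ⟩
    (x ⊛ y) ^ᴿ e           ≈⟨ ^-distrib-* x y e ⟩
    x ^ᴿ e ⊛ y ^ᴿ e        ≡⟨ cong₂ _⊛_ (pow≡^ x e) (pow≡^ y e) ⟨
    pow x e ⊛ pow y e      ∎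

  pow-one-∣ : ∀ {x d e} → pow x d ≈ 1# → d ∣ e → pow x e ≈ 1#
  pow-one-∣ {x} {d} x^d≈1 (divides q refl) = begin
    pow x (q * d)          ≡⟨ pow≡^ x (q * d) ⟩
    x ^ᴿ (q * d)           ≡⟨ cong (x ^ᴿ_) (ℕ.*-comm q d) ⟩
    x ^ᴿ (d * q)           ≈⟨ ^-assocʳ x d q ⟨
    (x ^ᴿ d) ^ᴿ q          ≡⟨ pow≡^ (x ^ᴿ d) q ⟨
    pow (x ^ᴿ d) q         ≡⟨ cong (λ z → pow z q) (pow≡^ x d) ⟨
    pow (pow x d) q        ≈⟨ pow-congˡ q x^d≈1 ⟩
    pow 1# q               ≈⟨ 1-pow q ⟩
    1#                     ∎

  pow-absorbʳ : ∀ {x z} e → pow z e ≈ 1# → pow (x ⊛ z) e ≈ pow x e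
  pow-absorbʳ {x} {z} e z^e≈1 = begin
    pow (x ⊛ z) e          ≈⟨ pow-distrib x z e ⟩
    pow x e ⊛ pow z e      ≈⟨ *-congˡ z^e≈1 ⟩
    pow x e ⊛ 1#           ≈⟨ *-identityʳ (pow x e) ⟩
    pow x e                ∎

  pow-absorbˡ : ∀ {x z} e → pow x e ≈ 1# → pow (x ⊛ z) e ≈ pow z e
  pow-absorbˡ {x} {z} e x^e≈1 = ≈-trans (pow-congˡ e (*-comm x z)) (pow-absorbʳ e x^e≈1)

  prod-pow-one : ∀ k (us : Fin k → Carrier) e → (∀ i → pow (us i) e ≈ 1#) → pow (prod k us) e ≈ 1#
  prod-pow-one zero    us e _ = 1-pow e
  prod-pow-one (suc k) us e h =
    ≈-trans (pow-absorbˡ e (h zero)) (prod-pow-one k (λ i → us (suc i)) e (λ i → h (suc i)))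

  prod-pow-head : ∀ k (us : Fin (suc k) → Carrier) e →
                  (∀ i → pow (us (suc i)) e ≈ 1#) → pow (prod (suc k) us) e ≈ pow (us zero) e
  prod-pow-head k us e h = pow-absorbʳ e (prod-pow-one k (λ i → us (suc i)) e h)

  prod-pow-last : ∀ k (us : Fin (suc k) → Carrier) e →
                  (∀ i → pow (us (inject₁ i)) e ≈ 1#) → pow (prod (suc k) us) e ≈ pow (us (fromℕ k)) e
  prod-pow-last zero    us e _ = pow-absorbʳ e (1-pow e)
  prod-pow-last (suc k) us e h =
    ≈-trans (pow-absorbˡ e (h zero)) (prod-pow-last k (λ i → us (suc i)) e (λ i → h (suc i)))

  subfield-unit : ∀ {a x z} → InSub a x → x ⊛ z ≈ 1# → pow x (2 ^ a ∸ 1) ≈ 1#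
  subfield-unit {a} {x} {z} x∈F xz≈1 = begin
    w                      ≈⟨ *-identityˡ w ⟨
    1# ⊛ w                 ≈⟨ *-congʳ (≈-trans (≈-sym xz≈1) (*-comm x z)) ⟩
    (z ⊛ x) ⊛ w            ≈⟨ *-assoc z x w ⟩
    z ⊛ pow x (suc (2 ^ a ∸ 1))  ≡⟨ cong (λ e → z ⊛ pow x e) (2^a≡1+[2^a∸1] a) ⟨
    z ⊛ pow x (2 ^ a)      ≈⟨ *-congˡ x∈F ⟩
    z ⊛ x                  ≈⟨ *-comm z x ⟩
    x ⊛ z                  ≈⟨ xz≈1 ⟩
    1#                     ∎
    where w = pow x (2 ^ a ∸ 1)

  Tr-cong : ∀ l {x y} → x ≈ y → Tr l x ≈ Tr l y
  Tr-cong zero    x≈y = ≈-refl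
  Tr-cong (suc l) x≈y = +-cong (pow-congˡ (2 ^ l) x≈y) (Tr-cong l x≈y)

  f-cong : ∀ n m₁ {a x x′} → pow x (2 ^ m₁ ∸ 1) ≈ pow x′ (2 ^ m₁ ∸ 1) → f n m₁ a x ≈ f n m₁ a x′
  f-cong n _ eq = Tr-cong n (*-congˡ eq)

  g-cong : ∀ n {b x x′} → pow x (ψ-exponent n) ≈ pow x′ (ψ-exponent n) → g n b x ≈ g n b x′
  g-cong _ eq = Tr-cong 2 (*-congˡ eq)

mainTheorem2 : {c ℓ : Level} (R : CommutativeRing c ℓ) (n ν' k : ℕ) →
  IsFieldOfOrder2^ R n →
  n ≡ 2 ^ suc ν' * k → k % 2 ≡ 1 →
  let open FieldNotions R
      ν = suc ν'
      m = mIdx ν k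
  in (a b y : Carrier) (us : Fin ν → Carrier) →
     ¬ (a ≈ 0#) →
     InSub 2 b → ¬ (b ≈ 0#) →
     (∀ (i : Fin ν) → InSub (m (toℕ i)) (us i) × pow (us i) (2 ^ m (suc (toℕ i)) + 1) ≈ 1#) →
     InSub (m ν) y → ¬ (y ≈ 0#) →
     (fab n (m 1) a b (prod ν us ⊛ y) ≈ fab n (m 1) a b (prod ν us))
     × (fab n (m 1) a b (prod ν us) ≈ f n (m 1) a (us zero) ⊕ g n b (us (fromℕ ν')))
mainTheorem2 R _ ν' k F refl k-odd a b y us _ _ _ us-order y∈F y≢0 = y-invisible , separation
  where
  open FieldNotions R using (_≈_; _⊛_; _⊕_; 1#; pow; prod; f; g; fab)
  open CommutativeRing R using (+-cong)
  open PowerLemmas R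
  open Arithmetic using (mersenne-∣; ψ-exponent)
  open Tower (suc ν') k
  open import Data.Nat.Divisibility using (∣-trans)
  open import Data.Fin.Properties using (toℕ<n; inject₁ℕ<)

  n e₁ E : ℕ
  n  = m 0
  e₁ = 2 ^ m 1 ∸ 1
  E  = ψ-exponent (m 0)

  -- y is a unit of F_{2^{m_ν}} = F_{2^k}, so its order divides 2^k - 1, and hence e₁ and E.
  y-unit : pow y (2 ^ m (suc ν') ∸ 1) ≈ 1#
  y-unit = subfield-unit {a = m (suc ν')} y∈F (proj₂ (IsFieldOfOrder2^.inverse F y y≢0))

  y-e₁ : pow y e₁ ≈ 1#
  y-e₁ = pow-one-∣ y-unit (mersenne-∣ (m-∣ {j = suc ν'} (s≤s z≤n)))

  y-E : pow y E ≈ 1#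
  y-E = pow-one-∣ y-unit (bottom-∣-ψ k-odd (s≤s z≤n))

  -- us (suc i) = u_{i+2} has order dividing 2^{m_{i+2}} + 1 ∣ 2^{m_{i+1}} - 1 ∣ e₁.
  tail-e₁ : ∀ i → pow (us (suc i)) e₁ ≈ 1#
  tail-e₁ i = pow-one-∣ (proj₂ (us-order (suc i)))
                (∣-trans (fermat-step (toℕ<n (suc i))) (mersenne-∣ (m-∣ {j = suc (toℕ i)} (s≤s z≤n))))

  -- u_1, …, u_{ν-1} have orders dividing 2^{m_i} + 1 with m_i even, hence dividing E.
  init-E : ∀ i → pow (us (inject₁ i)) E ≈ 1#
  init-E i = pow-one-∣ (proj₂ (us-order (inject₁ i))) (unit-circle-∣-ψ (s≤s (inject₁ℕ< i)))

  y-invisible : fab n (m 1) a b (prod (suc ν') us ⊛ y) ≈ fab n (m 1) a b (prod (suc ν') us)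
  y-invisible = +-cong (f-cong n (m 1) (pow-absorbʳ e₁ y-e₁)) (g-cong n (pow-absorbʳ E y-E))

  separation : fab n (m 1) a b (prod (suc ν') us) ≈ f n (m 1) a (us zero) ⊕ g n b (us (fromℕ ν'))
  separation = +-cong (f-cong n (m 1) (prod-pow-head ν' us e₁ tail-e₁))
                      (g-cong n (prod-pow-last ν' us E init-E))
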